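{- Let $r, n, q$ be positive integers. Suppose that for each $i\in[q]$ there exists a collection of $n$ matchings, each of size $t_i$, in an $r$-partite $r$-uniform hypergraph $H_i$ that does not admit a rainbow matching of size $t_i$. Then there exists a collection of $n$ matchings, each of size $\sum_{i=1}^q t_i$, in an $r$-partite $r$-uniform hypergraph $H$ that does not admit a rainbow matching of size $\sum_{i=1}^q t_i-q+1$.
   Context: A hypergraph is $r$-uniform if every edge has exactly $r$ vertices; an $r$-uniform hypergraph is $r$-partite if its vertex set can be partitioned into $r$ sets $V_1,\dots,V_r$ such that every edge contains exactly one vertex from each $V_i$. A matching is a set of pairwise vertex-disjoint edges. Given a collection of matchings $M_1,\dots,M_n$ in a hypergraph (not necessarily disjoint from each other), a matching $M\subseteq \bigcup_{i=1}^n M_i$ is rainbow if there is an injection $\phi: M\to[n]$ such that every edge $e\in M$ belongs to $M_{\phi(e)}$. -}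

module Defs where

open import Data.Nat using (ℕ; zero; suc; _+_)
open import Data.Fin using (Fin; zero; suc)
open import Data.Vec using (Vec; lookup)
open import Data.Product using (Σ; ∃; _×_; _,_)
open import Relation.Binary.PropositionalEquality using (_≡_; _≢_)
open import Relation.Nullary using (¬_)
open import Function.Definitions using (Injective)

-- Vertices of part j are the pairs (j , v) with v : ℕ; an edge contains
-- exactly one vertex from each part, so it is an r-tuple of labels.
Edge : ℕ → Set
Edge r = Fin r → ℕ

Hypergraph : ℕ → Set₁
Hypergraph r = Edge r → Set

-- Two edges are disjoint iff they share no vertex, i.e. differ in every part.
Disjoint : ∀ {r} → Edge r → Edge r → Set
Disjoint {r} e f = (j : Fin r) → e j ≢ f j

-- A matching of size t: t pairwise vertex-disjoint edges
-- (listed without repetition, since disjoint edges are distinct when r ≥ 1).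
IsMatching : ∀ {r t} → Vec (Edge r) t → Set
IsMatching {r} {t} M = (a b : Fin t) → a ≢ b → Disjoint (lookup M a) (lookup M b)

record Matching (r t : ℕ) : Set where
  constructor mkMatching
  field
    edges      : Vec (Edge r) t
    isMatching : IsMatching edges
open Matching public

_∈M_ : ∀ {r t} → Edge r → Matching r t → Set
e ∈M M = ∃ λ k → lookup (edges M) k ≡ e

InHypergraph : ∀ {r t} → Hypergraph r → Matching r t → Set
InHypergraph {t = t} H M = (k : Fin t) → H (lookup (edges M) k)

RainbowMatching : ∀ {r n t} → (Fin n → Matching r t) → ℕ → Set
RainbowMatching {r} {n} Ms s =
  Σ (Matching r s) λ M →
  Σ (Fin s → Fin n) λ φ →
    Injective _≡_ _≡_ φ × ((k : Fin s) → lookup (edges M) k ∈M Ms (φ k))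

∑ : ∀ {q} → (Fin q → ℕ) → ℕ
∑ {ℕ.zero}  t = 0
∑ {ℕ.suc q} t = t Fin.zero + ∑ (λ i → t (Fin.suc i))

-- Two families A and B of n matchings are merged coordinatewise into matchings
-- A x ⊕ B x, after relabelling every vertex v of A to 2v and every vertex of B
-- to 2v + 1, so that edges coming from A and from B are always disjoint.  A rainbow
-- matching of size (s₁ - 1) + s₂ of the merged family then has, by pigeonhole,
-- either s₁ edges coming from A or s₂ edges coming from B, and undoing the
-- relabelling gives a rainbow matching of A of size s₁ or of B of size s₂.
-- Folding this over t₁, …, t_q (each tᵢ ≥ 1, as the empty matching is rainbow)
-- loses one from the size of the forbidden rainbow matching at each merge.
module Submission where

open import Defs
open import Data.Nat using (ℕ; zero; suc; _<_; _+_; _*_; _∸_; pred; z<s; >-nonZero)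
open import Data.Nat.Properties
  using ( *-cancelˡ-≡; even≢odd; suc-injective; +-suc; +-assoc; +-comm; m+n∸m≡n; suc-pred
        ; +-commutativeSemigroup)
open import Algebra.Properties.CommutativeSemigroup +-commutativeSemigroup using (x∙yz≈y∙xz)
open import Data.Fin using (Fin; zero; suc; splitAt)
open import Data.Fin.Properties using (+↔⊎) renaming (suc-injective to fsuc-injective)
open import Data.Vec using ([]; lookup; tabulate)
open import Data.Vec.Properties using (lookup∘tabulate)
open import Data.Product using (Σ; _×_; _,_; proj₁; proj₂)
open import Data.Sum using (_⊎_; inj₁; inj₂; [_,_]′) renaming (map to map⊎)
open import Data.Unit using (⊤; tt)
open import Data.Empty using (⊥-elim)
open import Relation.Nullary using (¬_)
open import Relation.Binary.PropositionalEquality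
  using (_≡_; _≢_; refl; sym; trans; cong; cong₂; subst; subst₂; module ≡-Reasoning)
open import Function using (_∘_)
open import Function.Definitions using (Injective)
open import Function.Bundles using (Injection)
open import Function.Properties.Inverse using (↔⇒↣)

private
  variable
    r n s s₁ s₂ t t₁ t₂ : ℕ

Selection : ∀ {m} → (Fin m → Set) → ℕ → Set
Selection {m} P k = Σ (Fin k → Fin m) λ ι → Injective _≡_ _≡_ ι × (∀ x → P (ι x))

selection-[] : ∀ {m} {P : Fin m → Set} → Selection P 0
selection-[] = (λ ()) , (λ { {()} }) , (λ ())

module _ {m : ℕ} {P : Fin (suc m) → Set} where

  selection-skip : ∀ {k} → Selection (P ∘ suc) k → Selection P k
  selection-skip (ι , ι-inj , ι-P) = suc ∘ ι , ι-inj ∘ fsuc-injective , ι-P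

  selection-∷ : ∀ {k} → P zero → Selection (P ∘ suc) k → Selection P (suc k)
  selection-∷ {k} p₀ (ι , ι-inj , ι-P) = ι′ , ι′-inj , ι′-P
    where
    ι′ : Fin (suc k) → Fin (suc m)
    ι′ zero    = zero
    ι′ (suc x) = suc (ι x)

    ι′-inj : Injective _≡_ _≡_ ι′
    ι′-inj {zero}  {zero}  _ = refl
    ι′-inj {suc x} {suc y} e = cong suc (ι-inj (fsuc-injective e))

    ι′-P : ∀ x → P (ι′ x)
    ι′-P zero    = p₀
    ι′-P (suc x) = ι-P x

pigeonhole : ∀ {m} {P Q : Fin m → Set} → (∀ x → P x ⊎ Q x) →
             ∀ a b → a + b ≡ m → Selection P (suc a) ⊎ Selection Q b
pigeonhole {zero} {Q = Q} _ zero zero refl = inj₂ (selection-[] {P = Q})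
pigeonhole {suc m} {P} {Q} classify = go (classify zero)
  where
  rest : ∀ a b → a + b ≡ m → Selection (P ∘ suc) (suc a) ⊎ Selection (Q ∘ suc) b
  rest = pigeonhole (classify ∘ suc)

  go : P zero ⊎ Q zero → ∀ a b → a + b ≡ suc m → Selection P (suc a) ⊎ Selection Q b
  go (inj₁ p) zero    b _ = inj₁ (selection-∷ {P = P} p (selection-[] {P = P ∘ suc}))
  go (inj₁ p) (suc a) b e =
    map⊎ (selection-∷ {P = P} p) (selection-skip {P = Q}) (rest a b (suc-injective e))
  go (inj₂ q) a zero    _ = inj₂ (selection-[] {P = Q})
  go (inj₂ q) a (suc b) e =
    map⊎ (selection-skip {P = P}) (selection-∷ {P = Q} q)
         (rest a b (suc-injective (trans (sym (+-suc a b)) e)))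

PairwiseDisjoint : {I : Set} → (I → Edge r) → Set
PairwiseDisjoint {I = I} F = (a b : I) → a ≢ b → Disjoint (F a) (F b)

pairwiseDisjoint-∘ : {I J : Set} {F : I → Edge r} {ι : J → I} →
                     PairwiseDisjoint F → Injective _≡_ _≡_ ι → PairwiseDisjoint (F ∘ ι)
pairwiseDisjoint-∘ F-disj ι-inj a b a≢b = F-disj _ _ (a≢b ∘ ι-inj)

disjoint-preimage : (g : ℕ → ℕ) {e f : Edge r} → Disjoint (g ∘ e) (g ∘ f) → Disjoint e f
disjoint-preimage g disj j e≡f = disj j (cong g e≡f)

tabulate-isMatching : ∀ {k} {F : Fin k → Edge r} → PairwiseDisjoint F → IsMatching (tabulate F)
tabulate-isMatching {F = F} F-disj a b a≢b =
  subst₂ Disjoint (sym (lookup∘tabulate F a)) (sym (lookup∘tabulate F b)) (F-disj a b a≢b)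

InImage : (ℕ → ℕ) → Matching r t → Edge r → Set
InImage {r} g M e = Σ (Edge r) λ f → f ∈M M × g ∘ f ≡ e

rainbow-preimage : ∀ {k} (Ms : Fin n → Matching r t) (g : ℕ → ℕ)
                   (M : Matching r s) (φ : Fin s → Fin n) → Injective _≡_ _≡_ φ →
                   Selection (λ x → InImage g (Ms (φ x)) (lookup (edges M) x)) k →
                   RainbowMatching Ms k
rainbow-preimage Ms g M φ φ-inj (ι , ι-inj , lifted) =
  mkMatching (tabulate F) (tabulate-isMatching F-disj) , φ ∘ ι , ι-inj ∘ φ-inj ,
  λ x → subst (_∈M Ms (φ (ι x))) (sym (lookup∘tabulate F x)) (proj₁ (proj₂ (lifted x)))
  where
  F : Fin _ → Edge _
  F = proj₁ ∘ lifted

  F-disj : PairwiseDisjoint F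
  F-disj a b a≢b = disjoint-preimage g
    (subst₂ Disjoint (sym (proj₂ (proj₂ (lifted a)))) (sym (proj₂ (proj₂ (lifted b))))
      (pairwiseDisjoint-∘ (isMatching M) ι-inj a b a≢b))

rainbowMatching-0 : (Ms : Fin n → Matching r t) → RainbowMatching Ms 0
rainbowMatching-0 Ms = mkMatching [] (λ ()) , (λ ()) , (λ { {()} }) , (λ ())

¬rainbow-empty : (Ms : Fin n → Matching r 0) → ¬ RainbowMatching Ms (suc s)
¬rainbow-empty Ms (_ , φ , _ , mem) with mem zero
... | () , _

splitAt-injective : ∀ m {k} → Injective _≡_ _≡_ (splitAt m {k})
splitAt-injective m = Injection.injective (↔⇒↣ +↔⊎)

evenLabel oddLabel : ℕ → ℕ
evenLabel v = 2 * v
oddLabel  v = suc (2 * v)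

module _ (M : Matching r t₁) (N : Matching r t₂) where

  merged : Fin t₁ ⊎ Fin t₂ → Edge r
  merged = [ (λ i → evenLabel ∘ lookup (edges M) i) , (λ i → oddLabel ∘ lookup (edges N) i) ]′

  merged-disjoint : PairwiseDisjoint merged
  merged-disjoint (inj₁ i) (inj₁ i′) i≢i′ j e =
    isMatching M i i′ (i≢i′ ∘ cong inj₁) j (*-cancelˡ-≡ _ _ 2 e)
  merged-disjoint (inj₁ i) (inj₂ i′) _ j e =
    even≢odd (lookup (edges M) i j) (lookup (edges N) i′ j) e
  merged-disjoint (inj₂ i) (inj₁ i′) _ j e =
    even≢odd (lookup (edges M) i′ j) (lookup (edges N) i j) (sym e)
  merged-disjoint (inj₂ i) (inj₂ i′) i≢i′ j e =
    isMatching N i i′ (i≢i′ ∘ cong inj₂) j (*-cancelˡ-≡ _ _ 2 (suc-injective e))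

  merged-image : ∀ {e} x → merged x ≡ e → InImage evenLabel M e ⊎ InImage oddLabel N e
  merged-image (inj₁ i) eq = inj₁ (lookup (edges M) i , (i , refl) , eq)
  merged-image (inj₂ i) eq = inj₂ (lookup (edges N) i , (i , refl) , eq)

  infixr 5 _⊕_
  _⊕_ : Matching r (t₁ + t₂)
  _⊕_ = mkMatching (tabulate (merged ∘ splitAt t₁))
          (tabulate-isMatching (pairwiseDisjoint-∘ merged-disjoint (splitAt-injective t₁)))

  ∈M-⊕ : ∀ {e} → e ∈M _⊕_ → InImage evenLabel M e ⊎ InImage oddLabel N e
  ∈M-⊕ (p , eq) =
    merged-image (splitAt t₁ p) (trans (sym (lookup∘tabulate (merged ∘ splitAt t₁) p)) eq)

¬rainbow-⊕ : ∀ a b (A : Fin n → Matching r t₁) (B : Fin n → Matching r t₂) →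
             ¬ RainbowMatching A (suc a) → ¬ RainbowMatching B b →
             ¬ RainbowMatching (λ x → A x ⊕ B x) (a + b)
¬rainbow-⊕ a b A B ¬A ¬B (M , φ , φ-inj , mem) =
  [ ¬A ∘ rainbow-preimage A evenLabel M φ φ-inj
  , ¬B ∘ rainbow-preimage B oddLabel M φ φ-inj
  ]′
    (pigeonhole (λ x → ∈M-⊕ (A (φ x)) (B (φ x)) (mem x)) a b refl)

NoRainbow : ℕ → ℕ → ℕ → ℕ → Set
NoRainbow r n t s = Σ (Fin n → Matching r t) λ Ms → ¬ RainbowMatching Ms s

noRainbow⇒0< : NoRainbow r n t s → 0 < s
noRainbow⇒0< {s = zero}  (Ms , ¬R) = ⊥-elim (¬R (rainbowMatching-0 Ms))
noRainbow⇒0< {s = suc s} _         = z<s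

noRainbow-+ : NoRainbow r n t₁ s₁ → NoRainbow r n t₂ s₂ → NoRainbow r n (t₁ + t₂) (pred s₁ + s₂)
noRainbow-+ {s₁ = zero}  (A , ¬A) _ = ⊥-elim (¬A (rainbowMatching-0 A))
noRainbow-+ {s₁ = suc a} {s₂ = b} (A , ¬A) (B , ¬B) = (λ x → A x ⊕ B x) , ¬rainbow-⊕ a b A B ¬A ¬B

noRainbow-∑ : ∀ {q} (t : Fin q → ℕ) → (∀ i → NoRainbow r n (t i) (t i)) →
              NoRainbow r n (∑ t) (suc (∑ (pred ∘ t)))
noRainbow-∑ {q = zero}  t _ = empty , ¬rainbow-empty empty
  where
  empty : Fin _ → Matching _ 0
  empty _ = mkMatching [] (λ ())
noRainbow-∑ {q = suc q} t families =
  subst (NoRainbow _ _ (∑ t)) (+-suc (pred (t zero)) (∑ (pred ∘ t ∘ suc)))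
    (noRainbow-+ (families zero) (noRainbow-∑ (t ∘ suc) (families ∘ suc)))

∑-pred : ∀ {q} (t : Fin q → ℕ) → (∀ i → 0 < t i) → ∑ t ≡ q + ∑ (pred ∘ t)
∑-pred {zero}  t _   = refl
∑-pred {suc q} t t>0 = begin
  t zero + ∑ (t ∘ suc)
    ≡⟨ cong₂ _+_ (sym (suc-pred (t zero) {{>-nonZero (t>0 zero)}})) (∑-pred (t ∘ suc) (t>0 ∘ suc)) ⟩
  suc (pred (t zero) + (q + ∑ (pred ∘ t ∘ suc)))
    ≡⟨ cong suc (x∙yz≈y∙xz (pred (t zero)) q _) ⟩
  suc q + ∑ (pred ∘ t)
    ∎
  where open ≡-Reasoning

NoRainbowInHypergraph : ℕ → ℕ → ℕ → ℕ → Set₁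
NoRainbowInHypergraph r n t s = Σ (Hypergraph r) λ H → Σ (Fin n → Matching r t) λ Ms →
                            ((a : Fin n) → InHypergraph H (Ms a)) × ¬ RainbowMatching Ms s

forget-hypergraph : NoRainbowInHypergraph r n t s → NoRainbow r n t s
forget-hypergraph (_ , Ms , _ , ¬R) = Ms , ¬R

-- Rainbow matchings only use edges of the matchings, so H can be taken complete.
complete-hypergraph : NoRainbow r n t s → NoRainbowInHypergraph r n t s
complete-hypergraph (Ms , ¬R) = (λ _ → ⊤) , Ms , (λ _ _ → tt) , ¬R

lemma2p4 : (r n q : ℕ) → 0 < r → 0 < n → 0 < q → (t : Fin q → ℕ)
    → ((i : Fin q) → Σ (Hypergraph r) λ H → Σ (Fin n → Matching r (t i)) λ Ms
         → ((a : Fin n) → InHypergraph H (Ms a)) × ¬ RainbowMatching Ms (t i))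
    → Σ (Hypergraph r) λ H → Σ (Fin n → Matching r (∑ t)) λ Ms
         → ((a : Fin n) → InHypergraph H (Ms a)) × ¬ RainbowMatching Ms ((∑ t + 1) ∸ q)
lemma2p4 r n q _ _ _ t families =
  complete-hypergraph (subst (NoRainbow r n (∑ t)) size (noRainbow-∑ t noRainbow))
  where
  noRainbow : ∀ i → NoRainbow r n (t i) (t i)
  noRainbow = forget-hypergraph ∘ families

  u : ℕ
  u = ∑ (pred ∘ t)

  open ≡-Reasoning
  size : suc u ≡ ∑ t + 1 ∸ q
  size = begin
    suc u             ≡⟨ +-comm 1 u ⟩
    u + 1             ≡⟨ sym (m+n∸m≡n q (u + 1)) ⟩
    q + (u + 1) ∸ q   ≡⟨ cong (_∸ q) (sym (+-assoc q u 1)) ⟩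
    q + u + 1 ∸ q     ≡⟨ cong (λ m → m + 1 ∸ q) (sym (∑-pred t (noRainbow⇒0< ∘ noRainbow))) ⟩
    ∑ t + 1 ∸ q       ∎
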